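{- Let $S=\prod_{i=1}^k S_i$ be a unital semisimple ring with $S_i=Se_i=M_{q_i}(R_i)$ for division rings $R_i$, central idempotents $e_i$ and $q_i\geq1$, and let $M$ be a right $S$-module with $M_i:=Me_i$ infinite for each $i$. For each $n\geq1$, let $\Upsilon^n(M_S)$ be the group of pp-definable bijections $M^n\to M^n$ in $M_S$ and $\Upsilon^n((M_i)_{S_i})$ the group of pp-definable bijections $M_i^n\to M_i^n$ in $(M_i)_{S_i}$. Then $\Upsilon^n(M_S)\cong\prod_{i=1}^k\Upsilon^n((M_i)_{S_i})$.
   Context: A right $T$-module $N$ is a structure in the language $L_T=\langle +,-,0,\{\cdot_t:t\in T\}\rangle$. A positive primitive (pp) formula is one of the form $\exists\bar y\,\bigwedge_j(\text{linear equation in }\bar x,\bar y)$; a pp-definable bijection is a bijection whose graph is defined by a pp-formula with parameters from the module. -}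

module Defs where

open import Level using (Level; _⊔_; 0ℓ) renaming (suc to lsuc)
open import Algebra.Bundles using (Ring)
open import Algebra.Module.Bundles using (RightModule)
import Algebra.Module.Properties.RightModule as RMProps
open import Data.Nat using (ℕ) renaming (_+_ to _+ℕ_)
open import Data.Fin using (Fin; _≟_)
import Data.Fin as F
open import Data.Vec.Functional using (Vector; _++_)
open import Data.Product using (Σ; _×_; _,_; proj₁)
open import Relation.Nullary using (¬_; yes; no)
open import Relation.Binary.PropositionalEquality using (_≡_)

-- Structures in a module language L_T = < +, -, 0, { ·t : t ∈ T } >

record LStructure (t c ℓ : Level) : Set (lsuc (t ⊔ c ⊔ ℓ)) where
  infix  4 _≈_
  infixl 6 _+_
  infixl 7 _·_
  field
    Sym     : Set t
    Carrier : Set c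
    _≈_     : Carrier → Carrier → Set ℓ
    _+_     : Carrier → Carrier → Carrier
    -_      : Carrier → Carrier
    0#      : Carrier
    _·_     : Carrier → Sym → Carrier

module _ {t c ℓ : Level} (A : LStructure t c ℓ) where
  open LStructure A

  data Term (v : ℕ) : Set (t ⊔ c) where
    var : Fin v → Term v
    par : Carrier → Term v
    zer : Term v
    add : Term v → Term v → Term v
    neg : Term v → Term v
    act : Term v → Sym → Term v

  eval : ∀ {v} → Vector Carrier v → Term v → Carrier
  eval ρ (var i)   = ρ i
  eval ρ (par a)   = a
  eval ρ zer       = 0#
  eval ρ (add u w) = eval ρ u + eval ρ w
  eval ρ (neg u)   = - eval ρ u
  eval ρ (act u s) = eval ρ u · s

  -- pp-formula with parameters in free variables x_0..x_{n-1}: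
  --   ∃ y_0..y_{nex-1} . ⋀_{j < neq} (lhs j = rhs j)
  record PPFormula (n : ℕ) : Set (t ⊔ c) where
    field
      nex : ℕ
      neq : ℕ
      lhs : Fin neq → Term (n +ℕ nex)
      rhs : Fin neq → Term (n +ℕ nex)

  Sat : ∀ {n} → PPFormula n → Vector Carrier n → Set (c ⊔ ℓ)
  Sat φ x = Σ (Vector Carrier nex) λ y →
              ∀ j → eval (x ++ y) (lhs j) ≈ eval (x ++ y) (rhs j)
    where open PPFormula φ

  _≈ⁿ_ : ∀ {n} → Vector Carrier n → Vector Carrier n → Set ℓ
  x ≈ⁿ y = ∀ i → x i ≈ y i

  record IsPPDefBij {n : ℕ} (f : Vector Carrier n → Vector Carrier n)
                    : Set (t ⊔ c ⊔ ℓ) where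
    field
      f-cong     : ∀ {x y} → x ≈ⁿ y → f x ≈ⁿ f y
      injective  : ∀ {x y} → f x ≈ⁿ f y → x ≈ⁿ y
      surjective : ∀ y → Σ (Vector Carrier n) λ x → f x ≈ⁿ y
      graph      : PPFormula (n +ℕ n)
      defines    : ∀ x y → (Sat graph (x ++ y) → f x ≈ⁿ y)
                         × (f x ≈ⁿ y → Sat graph (x ++ y))

  -- Υ^n(A): the pp-definable bijections A^n → A^n.
  -- Its group structure: multiplication is composition, equality is
  -- extensional (_≈Υ_).
  Υ : ℕ → Set (t ⊔ c ⊔ ℓ)
  Υ n = Σ (Vector Carrier n → Vector Carrier n) IsPPDefBij

  _≈Υ_ : ∀ {n} → (Vector Carrier n → Vector Carrier n)
               → (Vector Carrier n → Vector Carrier n) → Set (c ⊔ ℓ)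
  f ≈Υ g = ∀ x → f x ≈ⁿ g x

-- A group isomorphism  Υ^n(A) ≅ ∏_{i<k} Υ^n(B i)
-- (a bijective map respecting the group multiplication = composition).
record ΥIsoProduct {t c ℓ t′ c′ ℓ′ : Level} (n : ℕ)
                   (A : LStructure t c ℓ) (k : ℕ)
                   (B : Fin k → LStructure t′ c′ ℓ′)
                   : Set (t ⊔ c ⊔ ℓ ⊔ t′ ⊔ c′ ⊔ ℓ′) where
  field
    to      : Υ A n → (∀ i → Υ (B i) n)
    to-cong : ∀ f g → _≈Υ_ A (proj₁ f) (proj₁ g)
                    → ∀ i → _≈Υ_ (B i) (proj₁ (to f i)) (proj₁ (to g i))
    to-inj  : ∀ f g → (∀ i → _≈Υ_ (B i) (proj₁ (to f i)) (proj₁ (to g i)))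
                    → _≈Υ_ A (proj₁ f) (proj₁ g)
    to-surj : ∀ (h : ∀ i → Υ (B i) n) →
                Σ (Υ A n) λ f → ∀ i → _≈Υ_ (B i) (proj₁ (to f i)) (proj₁ (h i))
    to-hom  : ∀ f g h → _≈Υ_ A (proj₁ h) (λ x → proj₁ f (proj₁ g x))
                      → ∀ i → _≈Υ_ (B i) (proj₁ (to h i))
                                     (λ x → proj₁ (to f i) (proj₁ (to g i) x))

Finite : ∀ {c ℓ} (C : Set c) → (C → C → Set ℓ) → Set (c ⊔ ℓ)
Finite C _≈_ = Σ ℕ λ N → Σ (Fin N → C) λ f → Σ (C → Fin N) λ g →
                 (∀ x → f (g x) ≈ x) × (∀ j → g (f j) ≡ j)

Infinite : ∀ {c ℓ} (C : Set c) → (C → C → Set ℓ) → Set (c ⊔ ℓ)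
Infinite C _≈_ = ¬ Finite C _≈_

module _ {r ℓr : Level} (R : Ring r ℓr) where
  open Ring R hiding (zero)

  ∑ : ∀ {k} → (Fin k → Carrier) → Carrier
  ∑ {ℕ.zero}  f = 0#
  ∑ {ℕ.suc k} f = f F.zero + ∑ (λ i → f (F.suc i))

  IsDivisionRing : Set (r ⊔ ℓr)
  IsDivisionRing = (¬ (1# ≈ 0#)) ×
    (∀ x → ¬ (x ≈ 0#) → Σ Carrier λ y → (x * y ≈ 1#) × (y * x ≈ 1#))

record RawURing (c ℓ : Level) : Set (lsuc (c ⊔ ℓ)) where
  field
    Carrier : Set c
    _≈_     : Carrier → Carrier → Set ℓ
    _+_     : Carrier → Carrier → Carrier
    _*_     : Carrier → Carrier → Carrier
    1#      : Carrier

record RingIso {c ℓ c′ ℓ′} (A : RawURing c ℓ) (B : RawURing c′ ℓ′)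
               : Set (c ⊔ ℓ ⊔ c′ ⊔ ℓ′) where
  private
    module A = RawURing A
    module B = RawURing B
  field
    φ        : A.Carrier → B.Carrier
    φ-cong   : ∀ {x y} → x A.≈ y → φ x B.≈ φ y
    φ-inj    : ∀ {x y} → φ x B.≈ φ y → x A.≈ y
    φ-surj   : ∀ b → Σ A.Carrier λ a → φ a B.≈ b
    φ-+      : ∀ x y → φ (x A.+ y) B.≈ (φ x B.+ φ y)
    φ-*      : ∀ x y → φ (x A.* y) B.≈ (φ x B.* φ y)
    φ-1      : φ A.1# B.≈ B.1#

Mat : ∀ {r ℓr} → Ring r ℓr → ℕ → RawURing r ℓr
Mat R q = record
  { Carrier = Fin q → Fin q → Carrier
  ; _≈_     = λ A B → ∀ i j → A i j ≈ B i j
  ; _+_     = λ A B i j → A i j + B i j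
  ; _*_     = λ A B i j → ∑ R (λ l → A i l * B l j)
  ; 1#      = δ
  }
  where
  open Ring R
  δ : Fin q → Fin q → Carrier
  δ i j with i ≟ j
  ... | yes _ = 1#
  ... | no  _ = 0#

-- the corner ring S e = { s e : s ∈ S } (unit e, for e a central idempotent)
module _ {r ℓr : Level} (S : Ring r ℓr) (e : Ring.Carrier S) where
  open Ring S

  SeCarrier : Set (r ⊔ ℓr)
  SeCarrier = Σ Carrier λ s → Σ Carrier λ s′ → s ≈ s′ * e

  Se : RawURing (r ⊔ ℓr) ℓr
  Se = record
    { Carrier = SeCarrier
    ; _≈_     = λ a b → proj₁ a ≈ proj₁ b
    ; _+_     = λ { (a , a′ , p) (b , b′ , q) →
                    (a + b , a′ + b′ , trans (+-cong p q) (sym (distribʳ e a′ b′))) }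
    ; _*_     = λ { (a , a′ , p) (b , b′ , q) →
                    (a * b , a′ * (e * b′) ,
                     trans (*-cong p q)
                       (trans (sym (*-assoc (a′ * e) b′ e))
                              (*-cong (*-assoc a′ e b′) refl))) }
    ; 1#      = (e , 1# , sym (*-identityˡ e))
    }

-- M e = { m e : m ∈ M } as an L_{Se}-structure, and M as an L_S-structure
module _ {r ℓr m ℓm : Level} {S : Ring r ℓr} (M : RightModule S m ℓm) where
  open Ring S
  open RightModule M
  open RMProps M

  asLStructure : LStructure r m ℓm
  asLStructure = record
    { Sym = Carrier ; Carrier = Carrierᴹ ; _≈_ = _≈ᴹ_ ; _+_ = _+ᴹ_
    ; -_ = -ᴹ_ ; 0# = 0ᴹ ; _·_ = _*ᵣ_ }

  module _ (e : Carrier) where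
    MeCarrier : Set (m ⊔ ℓm)
    MeCarrier = Σ Carrierᴹ λ x → Σ Carrierᴹ λ x′ → x ≈ᴹ x′ *ᵣ e

    private
      neg-e : ∀ x′ → (-ᴹ x′) *ᵣ e ≈ᴹ -ᴹ (x′ *ᵣ e)
      neg-e x′ = inverseʳ-uniqueᴹ (x′ *ᵣ e) ((-ᴹ x′) *ᵣ e)
        (≈ᴹ-trans (≈ᴹ-sym (*ᵣ-distribʳ e x′ (-ᴹ x′)))
          (≈ᴹ-trans (*ᵣ-cong (-ᴹ‿inverseʳ x′) refl) (*ᵣ-zeroˡ e)))

    MeStructure : LStructure (r ⊔ ℓr) (m ⊔ ℓm) ℓm
    MeStructure = record
      { Sym     = SeCarrier S e
      ; Carrier = MeCarrier
      ; _≈_     = λ a b → proj₁ a ≈ᴹ proj₁ b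
      ; _+_     = λ { (a , a′ , p) (b , b′ , q) →
                      (a +ᴹ b , a′ +ᴹ b′ ,
                       ≈ᴹ-trans (+ᴹ-cong p q) (≈ᴹ-sym (*ᵣ-distribʳ e a′ b′))) }
      ; -_      = λ { (a , a′ , p) →
                      (-ᴹ a , -ᴹ a′ , ≈ᴹ-trans (-ᴹ‿cong p) (≈ᴹ-sym (neg-e a′))) }
      ; 0#      = (0ᴹ , 0ᴹ , ≈ᴹ-sym (*ᵣ-zeroˡ e))
      ; _·_     = λ { (a , a′ , p) (s , s′ , q) →
                      (a *ᵣ s , a *ᵣ s′ ,
                       ≈ᴹ-trans (*ᵣ-cong ≈ᴹ-refl q) (≈ᴹ-sym (*ᵣ-assoc a s′ e))) }
      }

record SemisimpleDecomposition {r ℓr : Level} (S : Ring r ℓr) (k : ℕ)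
                               (ρ ℓρ : Level) : Set (r ⊔ ℓr ⊔ lsuc (ρ ⊔ ℓρ)) where
  open Ring S
  field
    e           : Fin k → Carrier
    central     : ∀ i s → e i * s ≈ s * e i
    idempotent  : ∀ i → e i * e i ≈ e i
    orthogonal  : ∀ i j → ¬ (i ≡ j) → e i * e j ≈ 0#
    sum-one     : ∑ S e ≈ 1#
    q           : Fin k → ℕ
    q≥1         : ∀ i → 1 Data.Nat.≤ q i
    R           : Fin k → Ring ρ ℓρ
    R-division  : ∀ i → IsDivisionRing (R i)
    Se≅Mat      : ∀ i → RingIso (Se S (e i)) (Mat (R i) (q i))

{-# OPTIONS --safe #-}

-- For a central idempotent e with complement ē = 1 - e, evaluation of terms commutes with
-- x ⋈ y := x e + y ē (parameters included, as a = a ⋈ a), so a pp-formula holding modulo e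
-- at x and modulo ē at y holds at x ⋈ y. Applied to the graph of a pp-definable bijection f
-- this shows that f x e only depends on x e. Hence f restricts to a bijection of (M e)ⁿ,
-- pp-definable by multiplying the parameters and scalars of its graph by e. Conversely,
-- bijections hᵢ of the (M eᵢ)ⁿ glue to x ↦ ∑ᵢ hᵢ (x eᵢ), whose graph is the conjunction of
-- the graphs of the hᵢ read in M. Since x = ∑ᵢ x eᵢ, restriction and gluing are inverse.
module Submission where

open import Defs
open import Level using (Level; _⊔_)
open import Algebra.Bundles using (Ring; CommutativeMonoid)
open import Algebra.Module.Bundles using (RightModule)
open import Data.Nat using (ℕ; _≤_)
open import Data.Fin using (Fin)

import Algebra.Module.Properties.RightModule as RightModuleProperties
import Algebra.Properties.AbelianGroup as AbelianGroupProperties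
import Algebra.Properties.CommutativeMonoid.Sum as CommutativeMonoidSum
import Algebra.Properties.CommutativeSemigroup as CommutativeSemigroupProperties
import Algebra.Properties.Ring as RingProperties
open import Data.Nat using (zero; suc) renaming (_+_ to _+ℕ_)
open import Data.Fin using (zero; suc; splitAt; _↑ˡ_; _↑ʳ_; punchIn)
open import Data.Fin.Properties using (punchInᵢ≢i)
open import Data.Product using (Σ; _×_; _,_; proj₁; proj₂)
open import Data.Sum using (inj₁; inj₂)
open import Data.Vec.Functional using (Vector; _++_; map; zipWith; removeAt; replicate)
open import Data.Vec.Functional.Properties using (lookup-++ˡ; lookup-++ʳ; ++-cong)
open import Data.Vec.Functional.Relation.Binary.Pointwise using (Pointwise)
open import Data.Vec.Functional.Relation.Binary.Pointwise.Properties using (++⁺; ++⁻ˡ; ++⁻ʳ)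
open import Function using (_∘_)
import Relation.Binary.PropositionalEquality as ≡
open ≡ using (_≡_; _≢_; _≗_)
import Relation.Binary.Reasoning.Setoid as SetoidReasoning

private
  variable
    ℓ₁ ℓ₂ ℓ₃ : Level
    A : Set ℓ₁
    B : Set ℓ₂
    C : Set ℓ₃

map-++ : ∀ {m n} (f : A → B) (xs : Vector A m) (ys : Vector A n) →
         map f (xs ++ ys) ≗ map f xs ++ map f ys
map-++ {m = m} f xs ys i with splitAt m i
... | inj₁ _ = ≡.refl
... | inj₂ _ = ≡.refl

zipWith-++ : ∀ {m n} (f : A → B → C) (xs : Vector A m) (xs′ : Vector A n) ys ys′ →
             zipWith f (xs ++ xs′) (ys ++ ys′) ≗ zipWith f xs ys ++ zipWith f xs′ ys′
zipWith-++ {m = m} f xs xs′ ys ys′ i with splitAt m i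
... | inj₁ _ = ≡.refl
... | inj₂ _ = ≡.refl

module _ {t c ℓ : Level} (A : LStructure t c ℓ) where
  open LStructure A
  open PPFormula

  eval-≗ : ∀ {v} {ρ ρ′ : Vector Carrier v} → ρ ≗ ρ′ → ∀ u → eval A ρ u ≡ eval A ρ′ u
  eval-≗ ρ≗ρ′ (var i)   = ρ≗ρ′ i
  eval-≗ ρ≗ρ′ (par a)   = ≡.refl
  eval-≗ ρ≗ρ′ zer       = ≡.refl
  eval-≗ ρ≗ρ′ (add u w) = ≡.cong₂ _+_ (eval-≗ ρ≗ρ′ u) (eval-≗ ρ≗ρ′ w)
  eval-≗ ρ≗ρ′ (neg u)   = ≡.cong -_ (eval-≗ ρ≗ρ′ u)
  eval-≗ ρ≗ρ′ (act u s) = ≡.cong (_· s) (eval-≗ ρ≗ρ′ u)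

  rename : ∀ {v w} → (Fin v → Fin w) → Term A v → Term A w
  rename r (var i)   = var (r i)
  rename r (par a)   = par a
  rename r zer       = zer
  rename r (add u w) = add (rename r u) (rename r w)
  rename r (neg u)   = neg (rename r u)
  rename r (act u s) = act (rename r u) s

  eval-rename : ∀ {v w} (r : Fin v → Fin w) {ρ : Vector Carrier w} {ρ′ : Vector Carrier v} →
                ρ ∘ r ≗ ρ′ → ∀ u → eval A ρ (rename r u) ≡ eval A ρ′ u
  eval-rename r eq (var i)   = eq i
  eval-rename r eq (par a)   = ≡.refl
  eval-rename r eq zer       = ≡.refl
  eval-rename r eq (add u w) = ≡.cong₂ _+_ (eval-rename r eq u) (eval-rename r eq w)
  eval-rename r eq (neg u)   = ≡.cong -_ (eval-rename r eq u)
  eval-rename r eq (act u s) = ≡.cong (_· s) (eval-rename r eq u)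

  _⊨_≐_ : ∀ {v} → Vector Carrier v → Term A v → Term A v → Set ℓ
  ρ ⊨ u ≐ u′ = eval A ρ u ≈ eval A ρ u′

  ≐-rename⁺ : ∀ {v w k} (r : Fin v → Fin w) {ρ ρ′} → ρ ∘ r ≗ ρ′ → (us us′ : Fin k → Term A v) →
              Pointwise (ρ′ ⊨_≐_) us us′ → Pointwise (ρ ⊨_≐_) (rename r ∘ us) (rename r ∘ us′)
  ≐-rename⁺ r eq us us′ holds j =
    ≡.subst₂ _≈_ (≡.sym (eval-rename r eq (us j))) (≡.sym (eval-rename r eq (us′ j))) (holds j)

  ≐-rename⁻ : ∀ {v w k} (r : Fin v → Fin w) {ρ ρ′} → ρ ∘ r ≗ ρ′ → (us us′ : Fin k → Term A v) →
              Pointwise (ρ ⊨_≐_) (rename r ∘ us) (rename r ∘ us′) → Pointwise (ρ′ ⊨_≐_) us us′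
  ≐-rename⁻ r eq us us′ holds j =
    ≡.subst₂ _≈_ (eval-rename r eq (us j)) (eval-rename r eq (us′ j)) (holds j)

  Sat-≗ : ∀ {n} (φ : PPFormula A n) {x x′ : Vector Carrier n} → x ≗ x′ → Sat A φ x → Sat A φ x′
  Sat-≗ φ x≗x′ (w , holds) = w , λ j →
    ≡.subst₂ _≈_ (eval-≗ ρ≗ρ′ (lhs φ j)) (eval-≗ ρ≗ρ′ (rhs φ j)) (holds j)
    where ρ≗ρ′ = ++-cong _ _ x≗x′ (λ _ → ≡.refl)

  -- Conjunctions of pp-formulas

  ⊤ᵖ : ∀ {n} → PPFormula A n
  ⊤ᵖ = record { nex = 0 ; neq = 0 ; lhs = λ () ; rhs = λ () }

  private
    embedˡ : ∀ n a b → Fin (n +ℕ a) → Fin (n +ℕ (a +ℕ b))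
    embedˡ n a b = (λ (i : Fin n) → i ↑ˡ (a +ℕ b)) ++ (λ (i : Fin a) → n ↑ʳ (i ↑ˡ b))

    embedʳ : ∀ n a b → Fin (n +ℕ b) → Fin (n +ℕ (a +ℕ b))
    embedʳ n a b = (λ (i : Fin n) → i ↑ˡ (a +ℕ b)) ++ (λ (i : Fin b) → n ↑ʳ (a ↑ʳ i))

    ++-∘-embedˡ : ∀ {n a b} (x : Vector Carrier n) (w : Vector Carrier (a +ℕ b)) →
                  (x ++ w) ∘ embedˡ n a b ≗ x ++ (w ∘ (_↑ˡ b))
    ++-∘-embedˡ {n} {a} {b} x w i = ≡.trans (map-++ {m = n} (x ++ w) _ _ i)
      (++-cong _ _ (lookup-++ˡ x w) (lookup-++ʳ x w ∘ (_↑ˡ _)) i)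

    ++-∘-embedʳ : ∀ {n a b} (x : Vector Carrier n) (w : Vector Carrier (a +ℕ b)) →
                  (x ++ w) ∘ embedʳ n a b ≗ x ++ (w ∘ (a ↑ʳ_))
    ++-∘-embedʳ {n} {a} {b} x w i = ≡.trans (map-++ {m = n} (x ++ w) _ _ i)
      (++-cong _ _ (lookup-++ˡ x w) (lookup-++ʳ x w ∘ (a ↑ʳ_)) i)

  infixr 5 _∧ᵖ_
  _∧ᵖ_ : ∀ {n} → PPFormula A n → PPFormula A n → PPFormula A n
  _∧ᵖ_ {n} φ ψ = record
    { nex = nex φ +ℕ nex ψ
    ; neq = neq φ +ℕ neq ψ
    ; lhs = (rename (embedˡ n _ _) ∘ lhs φ) ++ (rename (embedʳ n _ _) ∘ lhs ψ)
    ; rhs = (rename (embedˡ n _ _) ∘ rhs φ) ++ (rename (embedʳ n _ _) ∘ rhs ψ)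
    }

  Sat-∧ᵖ⁻ : ∀ {n} (φ ψ : PPFormula A n) {x} → Sat A (φ ∧ᵖ ψ) x → Sat A φ x × Sat A ψ x
  Sat-∧ᵖ⁻ φ ψ {x} (w , holds) =
      (w ∘ (_↑ˡ _) , ≐-rename⁻ _ (++-∘-embedˡ x w) (lhs φ) (rhs φ) (++⁻ˡ ((x ++ w) ⊨_≐_) _ _ holds))
    , (w ∘ (_ ↑ʳ_) , ≐-rename⁻ _ (++-∘-embedʳ x w) (lhs ψ) (rhs ψ) (++⁻ʳ ((x ++ w) ⊨_≐_) _ _ holds))

  Sat-∧ᵖ⁺ : ∀ {n} (φ ψ : PPFormula A n) {x} → Sat A φ x → Sat A ψ x → Sat A (φ ∧ᵖ ψ) x
  Sat-∧ᵖ⁺ φ ψ {x} (w , holds) (w′ , holds′) = w ++ w′ , ++⁺ ((x ++ (w ++ w′)) ⊨_≐_)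
    (≐-rename⁺ _ (λ i → ≡.trans (++-∘-embedˡ x (w ++ w′) i)
                                (++-cong _ _ (λ _ → ≡.refl) (lookup-++ˡ w w′) i)) (lhs φ) (rhs φ) holds)
    (≐-rename⁺ _ (λ i → ≡.trans (++-∘-embedʳ x (w ++ w′) i)
                                (++-cong _ _ (λ _ → ≡.refl) (lookup-++ʳ w w′) i)) (lhs ψ) (rhs ψ) holds′)

  ⋀ᵖ : ∀ {n k} → (Fin k → PPFormula A n) → PPFormula A n
  ⋀ᵖ {k = zero}  φ = ⊤ᵖ
  ⋀ᵖ {k = suc k} φ = φ zero ∧ᵖ ⋀ᵖ (φ ∘ suc)

  Sat-⋀ᵖ⁻ : ∀ {n k} (φ : Fin k → PPFormula A n) {x} → Sat A (⋀ᵖ φ) x → ∀ i → Sat A (φ i) x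
  Sat-⋀ᵖ⁻ φ sat zero    = proj₁ (Sat-∧ᵖ⁻ (φ zero) _ sat)
  Sat-⋀ᵖ⁻ φ sat (suc i) = Sat-⋀ᵖ⁻ (φ ∘ suc) (proj₂ (Sat-∧ᵖ⁻ (φ zero) _ sat)) i

  Sat-⋀ᵖ⁺ : ∀ {n k} (φ : Fin k → PPFormula A n) {x} → (∀ i → Sat A (φ i) x) → Sat A (⋀ᵖ φ) x
  Sat-⋀ᵖ⁺ {k = zero}  φ sat = (λ ()) , (λ ())
  Sat-⋀ᵖ⁺ {k = suc k} φ sat = Sat-∧ᵖ⁺ (φ zero) _ (sat zero) (Sat-⋀ᵖ⁺ (φ ∘ suc) (sat ∘ suc))

module _ {r ℓr : Level} (S : Ring r ℓr) where
  open Ring S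
  open RingProperties S using ([y-z]x≈yx-zx; x[y-z]≈xy-xz; -0#≈0#)
  open SetoidReasoning setoid

  Central : Carrier → Set (r ⊔ ℓr)
  Central c = ∀ s → c * s ≈ s * c

  record IsCentralIdempotent (e : Carrier) : Set (r ⊔ ℓr) where
    field
      central    : Central e
      idempotent : e * e ≈ e

  x+[1-x]≈1 : ∀ x → x + (1# - x) ≈ 1#
  x+[1-x]≈1 x = begin
    x + (1# - x)    ≈⟨ +-assoc x 1# (- x) ⟨
    (x + 1#) - x    ≈⟨ +-congʳ (+-comm x 1#) ⟩
    (1# + x) - x    ≈⟨ +-assoc 1# x (- x) ⟩
    1# + (x - x)    ≈⟨ +-congˡ (-‿inverseʳ x) ⟩
    1# + 0#         ≈⟨ +-identityʳ 1# ⟩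
    1#              ∎

  module _ {e : Carrier} (e-idem : e * e ≈ e) where

    [1-e]*e≈0 : (1# - e) * e ≈ 0#
    [1-e]*e≈0 = begin
      (1# - e) * e    ≈⟨ [y-z]x≈yx-zx e 1# e ⟩
      1# * e - e * e  ≈⟨ +-cong (*-identityˡ e) (-‿cong e-idem) ⟩
      e - e           ≈⟨ -‿inverseʳ e ⟩
      0#              ∎

    e*[1-e]≈0 : e * (1# - e) ≈ 0#
    e*[1-e]≈0 = begin
      e * (1# - e)    ≈⟨ x[y-z]≈xy-xz e 1# e ⟩
      e * 1# - e * e  ≈⟨ +-cong (*-identityʳ e) (-‿cong e-idem) ⟩
      e - e           ≈⟨ -‿inverseʳ e ⟩
      0#              ∎

  complement : ∀ {e} → IsCentralIdempotent e → IsCentralIdempotent (1# - e)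
  complement {e} e-ci = record
    { central    = λ s → begin
        (1# - e) * s      ≈⟨ [y-z]x≈yx-zx s 1# e ⟩
        1# * s - e * s    ≈⟨ +-cong (trans (*-identityˡ s) (sym (*-identityʳ s))) (-‿cong (central s)) ⟩
        s * 1# - s * e    ≈⟨ x[y-z]≈xy-xz s 1# e ⟨
        s * (1# - e)      ∎
    ; idempotent = begin
        (1# - e) * (1# - e)               ≈⟨ [y-z]x≈yx-zx (1# - e) 1# e ⟩
        1# * (1# - e) - e * (1# - e)      ≈⟨ +-cong (*-identityˡ (1# - e)) (-‿cong (e*[1-e]≈0 idempotent)) ⟩
        (1# - e) - 0#                     ≈⟨ +-congˡ -0#≈0# ⟩
        (1# - e) + 0#                     ≈⟨ +-identityʳ (1# - e) ⟩
        1# - e                            ∎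
    }
    where open IsCentralIdempotent e-ci

module _ {r ℓr m ℓm : Level} {S : Ring r ℓr} (M : RightModule S m ℓm) where
  open Ring S
  open RightModule M
  open RightModuleProperties M using (inverseʳ-uniqueᴹ)
  open AbelianGroupProperties +ᴹ-abelianGroup using (⁻¹-∙-comm)
  open CommutativeSemigroupProperties (CommutativeMonoid.commutativeSemigroup +ᴹ-commutativeMonoid)
    using (interchange)
  open CommutativeMonoidSum +ᴹ-commutativeMonoid using (sum; sum-cong-≋; sum-remove; sum-replicate-zero)
  open PPFormula
  open SetoidReasoning ≈ᴹ-setoid

  private
    Mᴸ : LStructure r m ℓm
    Mᴸ = asLStructure M

  infix 4 _≈[_]_
  _≈[_]_ : Carrierᴹ → Carrier → Carrierᴹ → Set ℓm
  x ≈[ c ] y = x *ᵣ c ≈ᴹ y *ᵣ c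

  ≗⇒≈[] : ∀ c {n} {x y : Vector Carrierᴹ n} → x ≗ y → Pointwise _≈[ c ]_ x y
  ≗⇒≈[] c x≗y i = *ᵣ-congʳ (≈ᴹ-reflexive (x≗y i))

  -ᴹ‿distribˡ-*ᵣ : ∀ x s → -ᴹ (x *ᵣ s) ≈ᴹ (-ᴹ x) *ᵣ s
  -ᴹ‿distribˡ-*ᵣ x s = ≈ᴹ-sym (inverseʳ-uniqueᴹ (x *ᵣ s) ((-ᴹ x) *ᵣ s) (begin
    x *ᵣ s +ᴹ (-ᴹ x) *ᵣ s  ≈⟨ *ᵣ-distribʳ s x (-ᴹ x) ⟨
    (x +ᴹ -ᴹ x) *ᵣ s       ≈⟨ *ᵣ-congʳ (-ᴹ‿inverseʳ x) ⟩
    0ᴹ *ᵣ s                ≈⟨ *ᵣ-zeroˡ s ⟩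
    0ᴹ                     ∎))

  *ᵣ-comm-central : ∀ {c} → Central S c → ∀ x s → (x *ᵣ s) *ᵣ c ≈ᴹ (x *ᵣ c) *ᵣ s
  *ᵣ-comm-central {c} c-central x s = begin
    (x *ᵣ s) *ᵣ c  ≈⟨ *ᵣ-assoc x s c ⟩
    x *ᵣ (s * c)   ≈⟨ *ᵣ-congˡ (c-central s) ⟨
    x *ᵣ (c * s)   ≈⟨ *ᵣ-assoc x c s ⟨
    (x *ᵣ c) *ᵣ s  ∎

  module _ {c : Carrier} (c-central : Central S c) {v} {ρ ρ′ : Vector Carrierᴹ v}
           (ρ≈ρ′ : Pointwise _≈[ c ]_ ρ ρ′) where
    private
      ⟦_⟧ ⟦_⟧′ : Term Mᴸ v → Carrierᴹ
      ⟦_⟧  = eval Mᴸ ρ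
      ⟦_⟧′ = eval Mᴸ ρ′

    eval-≈[]-cong : ∀ u → ⟦ u ⟧ ≈[ c ] ⟦ u ⟧′
    eval-≈[]-cong (var i)   = ρ≈ρ′ i
    eval-≈[]-cong (par a)   = ≈ᴹ-refl
    eval-≈[]-cong zer       = ≈ᴹ-refl
    eval-≈[]-cong (add u w) = begin
      (⟦ u ⟧ +ᴹ ⟦ w ⟧) *ᵣ c         ≈⟨ *ᵣ-distribʳ c _ _ ⟩
      ⟦ u ⟧ *ᵣ c +ᴹ ⟦ w ⟧ *ᵣ c      ≈⟨ +ᴹ-cong (eval-≈[]-cong u) (eval-≈[]-cong w) ⟩
      ⟦ u ⟧′ *ᵣ c +ᴹ ⟦ w ⟧′ *ᵣ c    ≈⟨ *ᵣ-distribʳ c _ _ ⟨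
      (⟦ u ⟧′ +ᴹ ⟦ w ⟧′) *ᵣ c       ∎
    eval-≈[]-cong (neg u)   = begin
      (-ᴹ ⟦ u ⟧) *ᵣ c               ≈⟨ -ᴹ‿distribˡ-*ᵣ _ c ⟨
      -ᴹ (⟦ u ⟧ *ᵣ c)               ≈⟨ -ᴹ‿cong (eval-≈[]-cong u) ⟩
      -ᴹ (⟦ u ⟧′ *ᵣ c)              ≈⟨ -ᴹ‿distribˡ-*ᵣ _ c ⟩
      (-ᴹ ⟦ u ⟧′) *ᵣ c              ∎
    eval-≈[]-cong (act u s) = begin
      (⟦ u ⟧ *ᵣ s) *ᵣ c             ≈⟨ *ᵣ-comm-central c-central _ s ⟩
      (⟦ u ⟧ *ᵣ c) *ᵣ s             ≈⟨ *ᵣ-congʳ (eval-≈[]-cong u) ⟩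
      (⟦ u ⟧′ *ᵣ c) *ᵣ s            ≈⟨ *ᵣ-comm-central c-central _ s ⟨
      (⟦ u ⟧′ *ᵣ s) *ᵣ c            ∎

  module _ {c d : Carrier} (c-central : Central S c) (d-central : Central S d) (c+d≈1 : c + d ≈ 1#)
           {v} (ρ ρ′ : Vector Carrierᴹ v) where
    private
      ⟦_⟧ ⟦_⟧′ ⟦_⟧ᶜᵈ : Term Mᴸ v → Carrierᴹ
      ⟦_⟧   = eval Mᴸ ρ
      ⟦_⟧′  = eval Mᴸ ρ′
      ⟦_⟧ᶜᵈ = eval Mᴸ (zipWith (λ x y → x *ᵣ c +ᴹ y *ᵣ d) ρ ρ′)

    eval-mix : ∀ u → ⟦ u ⟧ᶜᵈ ≈ᴹ ⟦ u ⟧ *ᵣ c +ᴹ ⟦ u ⟧′ *ᵣ d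
    eval-mix (var i)   = ≈ᴹ-refl
    eval-mix (par a)   = begin
      a                      ≈⟨ *ᵣ-identityʳ a ⟨
      a *ᵣ 1#                ≈⟨ *ᵣ-congˡ c+d≈1 ⟨
      a *ᵣ (c + d)           ≈⟨ *ᵣ-distribˡ a c d ⟩
      a *ᵣ c +ᴹ a *ᵣ d       ∎
    eval-mix zer       = begin
      0ᴹ                     ≈⟨ +ᴹ-identityˡ 0ᴹ ⟨
      0ᴹ +ᴹ 0ᴹ               ≈⟨ +ᴹ-cong (*ᵣ-zeroˡ c) (*ᵣ-zeroˡ d) ⟨
      0ᴹ *ᵣ c +ᴹ 0ᴹ *ᵣ d     ∎
    eval-mix (add u w) = begin
      ⟦ u ⟧ᶜᵈ +ᴹ ⟦ w ⟧ᶜᵈ                                       ≈⟨ +ᴹ-cong (eval-mix u) (eval-mix w) ⟩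
      (⟦ u ⟧ *ᵣ c +ᴹ ⟦ u ⟧′ *ᵣ d) +ᴹ (⟦ w ⟧ *ᵣ c +ᴹ ⟦ w ⟧′ *ᵣ d) ≈⟨ interchange _ _ _ _ ⟩
      (⟦ u ⟧ *ᵣ c +ᴹ ⟦ w ⟧ *ᵣ c) +ᴹ (⟦ u ⟧′ *ᵣ d +ᴹ ⟦ w ⟧′ *ᵣ d) ≈⟨ +ᴹ-cong (*ᵣ-distribʳ c _ _)
                                                                            (*ᵣ-distribʳ d _ _) ⟨
      (⟦ u ⟧ +ᴹ ⟦ w ⟧) *ᵣ c +ᴹ (⟦ u ⟧′ +ᴹ ⟦ w ⟧′) *ᵣ d         ∎
    eval-mix (neg u)   = begin
      -ᴹ ⟦ u ⟧ᶜᵈ                                  ≈⟨ -ᴹ‿cong (eval-mix u) ⟩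
      -ᴹ (⟦ u ⟧ *ᵣ c +ᴹ ⟦ u ⟧′ *ᵣ d)              ≈⟨ ⁻¹-∙-comm _ _ ⟨
      -ᴹ (⟦ u ⟧ *ᵣ c) +ᴹ -ᴹ (⟦ u ⟧′ *ᵣ d)         ≈⟨ +ᴹ-cong (-ᴹ‿distribˡ-*ᵣ _ c) (-ᴹ‿distribˡ-*ᵣ _ d) ⟩
      (-ᴹ ⟦ u ⟧) *ᵣ c +ᴹ (-ᴹ ⟦ u ⟧′) *ᵣ d         ∎
    eval-mix (act u s) = begin
      ⟦ u ⟧ᶜᵈ *ᵣ s                                ≈⟨ *ᵣ-congʳ (eval-mix u) ⟩
      (⟦ u ⟧ *ᵣ c +ᴹ ⟦ u ⟧′ *ᵣ d) *ᵣ s            ≈⟨ *ᵣ-distribʳ s _ _ ⟩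
      (⟦ u ⟧ *ᵣ c) *ᵣ s +ᴹ (⟦ u ⟧′ *ᵣ d) *ᵣ s     ≈⟨ +ᴹ-cong (*ᵣ-comm-central c-central _ s)
                                                             (*ᵣ-comm-central d-central _ s) ⟨
      (⟦ u ⟧ *ᵣ s) *ᵣ c +ᴹ (⟦ u ⟧′ *ᵣ s) *ᵣ d     ∎

  SatProj : Carrier → ∀ {n} → PPFormula Mᴸ n → Vector Carrierᴹ n → Set (m ⊔ ℓm)
  SatProj c φ x = Σ (Vector Carrierᴹ (nex φ)) λ w →
    Pointwise (λ u u′ → eval Mᴸ (x ++ w) u ≈[ c ] eval Mᴸ (x ++ w) u′) (lhs φ) (rhs φ)

  Sat⇒SatProj : ∀ c {n} (φ : PPFormula Mᴸ n) {x} → Sat Mᴸ φ x → SatProj c φ x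
  Sat⇒SatProj c φ (w , holds) = w , λ j → *ᵣ-congʳ (holds j)

  SatProj-cong : ∀ {c} → Central S c → ∀ {n} (φ : PPFormula Mᴸ n) {x x′} →
                 Pointwise _≈[ c ]_ x x′ → SatProj c φ x → SatProj c φ x′
  SatProj-cong {c} c-central φ {x} {x′} x≈x′ (w , holds) = w , λ j → begin
    eval Mᴸ (x′ ++ w) (lhs φ j) *ᵣ c  ≈⟨ eval-≈[]-cong c-central ρ≈ρ′ (lhs φ j) ⟨
    eval Mᴸ (x ++ w) (lhs φ j) *ᵣ c   ≈⟨ holds j ⟩
    eval Mᴸ (x ++ w) (rhs φ j) *ᵣ c   ≈⟨ eval-≈[]-cong c-central ρ≈ρ′ (rhs φ j) ⟩
    eval Mᴸ (x′ ++ w) (rhs φ j) *ᵣ c  ∎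
    where ρ≈ρ′ = ++⁺ _≈[ c ]_ x≈x′ (λ _ → ≈ᴹ-refl)

  module CentralIdempotent {e : Carrier} (e-ci : IsCentralIdempotent S e) where
    open IsCentralIdempotent e-ci renaming (central to e-central; idempotent to e-idem)
    open IsCentralIdempotent (complement S e-ci) using () renaming (central to ē-central)

    ē : Carrier
    ē = 1# - e

    infixl 6 _⋈_
    _⋈_ : Carrierᴹ → Carrierᴹ → Carrierᴹ
    x ⋈ y = x *ᵣ e +ᴹ y *ᵣ ē

    *ᵣe≈[e] : ∀ x → x *ᵣ e ≈[ e ] x
    *ᵣe≈[e] x = ≈ᴹ-trans (*ᵣ-assoc x e e) (*ᵣ-congˡ e-idem)

    ⋈≈[e] : ∀ x y → x ⋈ y ≈[ e ] x
    ⋈≈[e] x y = begin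
      (x *ᵣ e +ᴹ y *ᵣ ē) *ᵣ e        ≈⟨ *ᵣ-distribʳ e _ _ ⟩
      (x *ᵣ e) *ᵣ e +ᴹ (y *ᵣ ē) *ᵣ e ≈⟨ +ᴹ-cong (*ᵣe≈[e] x) (*ᵣ-assoc y ē e) ⟩
      x *ᵣ e +ᴹ y *ᵣ (ē * e)         ≈⟨ +ᴹ-congˡ (≈ᴹ-trans (*ᵣ-congˡ ([1-e]*e≈0 S e-idem)) (*ᵣ-zeroʳ y)) ⟩
      x *ᵣ e +ᴹ 0ᴹ                   ≈⟨ +ᴹ-identityʳ _ ⟩
      x *ᵣ e                         ∎

    x⋈x≈x : ∀ x → x ⋈ x ≈ᴹ x
    x⋈x≈x x = begin
      x *ᵣ e +ᴹ x *ᵣ ē  ≈⟨ *ᵣ-distribˡ x e ē ⟨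
      x *ᵣ (e + ē)      ≈⟨ *ᵣ-congˡ (x+[1-x]≈1 S e) ⟩
      x *ᵣ 1#           ≈⟨ *ᵣ-identityʳ x ⟩
      x                 ∎

    ≈[e]∧≈[ē]⇒≈ : ∀ {x y} → x ≈[ e ] y → x ≈[ ē ] y → x ≈ᴹ y
    ≈[e]∧≈[ē]⇒≈ {x} {y} x≈[e]y x≈[ē]y = begin
      x       ≈⟨ x⋈x≈x x ⟨
      x ⋈ x   ≈⟨ +ᴹ-cong x≈[e]y x≈[ē]y ⟩
      y ⋈ y   ≈⟨ x⋈x≈x y ⟩
      y       ∎

    Sat-⋈ : ∀ {n} (φ : PPFormula Mᴸ n) {x y} → SatProj e φ x → SatProj ē φ y →
            Sat Mᴸ φ (zipWith _⋈_ x y)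
    Sat-⋈ φ {x} {y} (w , holds) (w′ , holds′) = zipWith _⋈_ w w′ , λ j → begin
      ⟦ lhs φ j ⟧                                               ≈⟨ eval-⋈ (lhs φ j) ⟩
      eval Mᴸ (x ++ w) (lhs φ j) ⋈ eval Mᴸ (y ++ w′) (lhs φ j)  ≈⟨ +ᴹ-cong (holds j) (holds′ j) ⟩
      eval Mᴸ (x ++ w) (rhs φ j) ⋈ eval Mᴸ (y ++ w′) (rhs φ j)  ≈⟨ eval-⋈ (rhs φ j) ⟨
      ⟦ rhs φ j ⟧                                               ∎
      where
      ⟦_⟧ : Term Mᴸ _ → Carrierᴹ
      ⟦_⟧ = eval Mᴸ (zipWith _⋈_ x y ++ zipWith _⋈_ w w′)
      eval-⋈ : ∀ u → ⟦ u ⟧ ≈ᴹ eval Mᴸ (x ++ w) u ⋈ eval Mᴸ (y ++ w′) u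
      eval-⋈ u = ≈ᴹ-trans (≈ᴹ-reflexive (eval-≗ Mᴸ (≡.sym ∘ zipWith-++ _⋈_ x w y w′) u))
        (eval-mix e-central ē-central (x+[1-x]≈1 S e) (x ++ w) (y ++ w′) u)

    module _ {n} {f : Vector Carrierᴹ n → Vector Carrierᴹ n} (f-pp : IsPPDefBij Mᴸ f) where
      open IsPPDefBij f-pp

      SatProj-graph⇒ : ∀ {x y} → SatProj e graph (x ++ y) → Pointwise _≈[ e ]_ (f x) y
      SatProj-graph⇒ {x} {y} sat j = begin
        f x j *ᵣ e                  ≈⟨ *ᵣ-congʳ (f-cong (λ i → x⋈x≈x (x i)) j) ⟨
        f (zipWith _⋈_ x x) j *ᵣ e  ≈⟨ *ᵣ-congʳ (f-mixed j) ⟩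
        (y j ⋈ f x j) *ᵣ e          ≈⟨ ⋈≈[e] (y j) (f x j) ⟩
        y j *ᵣ e                    ∎
        where
        graph-mixed : Sat Mᴸ graph (zipWith _⋈_ x x ++ zipWith _⋈_ y (f x))
        graph-mixed = Sat-≗ Mᴸ graph (zipWith-++ _⋈_ x y x (f x))
          (Sat-⋈ graph sat (Sat⇒SatProj ē graph (proj₂ (defines x (f x)) (λ _ → ≈ᴹ-refl))))
        f-mixed : Pointwise _≈ᴹ_ (f (zipWith _⋈_ x x)) (zipWith _⋈_ y (f x))
        f-mixed = proj₁ (defines _ _) graph-mixed

      f-≈[e]-cong : ∀ {x y} → Pointwise _≈[ e ]_ x y → Pointwise _≈[ e ]_ (f x) (f y)
      f-≈[e]-cong {x} {y} x≈[e]y = SatProj-graph⇒ (SatProj-cong e-central graph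
        (++⁺ _≈[ e ]_ (λ i → ≈ᴹ-sym (x≈[e]y i)) (λ _ → ≈ᴹ-refl))
        (Sat⇒SatProj e graph (proj₂ (defines y (f y)) (λ _ → ≈ᴹ-refl))))

  -- The component M e of a central idempotent e

  module Component {e : Carrier} (e-ci : IsCentralIdempotent S e) where
    open IsCentralIdempotent e-ci renaming (central to e-central; idempotent to e-idem)
    open CentralIdempotent e-ci public
    private
      module Ē = CentralIdempotent (complement S e-ci)

    Mₑ : LStructure (r ⊔ ℓr) (m ⊔ ℓm) ℓm
    Mₑ = MeStructure M e

    private
      _≈ₑ_ : MeCarrier M e → MeCarrier M e → Set ℓm
      _≈ₑ_ = LStructure._≈_ Mₑ

    project : Carrierᴹ → MeCarrier M e
    project x = x *ᵣ e , x , ≈ᴹ-refl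

    Me-fixed : (x : MeCarrier M e) → proj₁ x ≈ᴹ proj₁ x *ᵣ e
    Me-fixed (x , x′ , x≈x′e) = begin
      x               ≈⟨ x≈x′e ⟩
      x′ *ᵣ e         ≈⟨ *ᵣe≈[e] x′ ⟨
      (x′ *ᵣ e) *ᵣ e  ≈⟨ *ᵣ-congʳ x≈x′e ⟨
      x *ᵣ e          ∎

    Me-*ᵣē≈0 : (x : MeCarrier M e) → proj₁ x *ᵣ ē ≈ᴹ 0ᴹ
    Me-*ᵣē≈0 (x , x′ , x≈x′e) = begin
      x *ᵣ ē          ≈⟨ *ᵣ-congʳ x≈x′e ⟩
      (x′ *ᵣ e) *ᵣ ē  ≈⟨ *ᵣ-assoc x′ e ē ⟩
      x′ *ᵣ (e * ē)   ≈⟨ *ᵣ-congˡ (e*[1-e]≈0 S e-idem) ⟩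
      x′ *ᵣ 0#        ≈⟨ *ᵣ-zeroʳ x′ ⟩
      0ᴹ              ∎

    projectTerm : ∀ {v} → Term Mᴸ v → Term Mₑ v
    projectTerm (var i)   = var i
    projectTerm (par a)   = par (project a)
    projectTerm zer       = zer
    projectTerm (add u w) = add (projectTerm u) (projectTerm w)
    projectTerm (neg u)   = neg (projectTerm u)
    projectTerm (act u s) = act (projectTerm u) (s * e , s , refl)

    eval-projectTerm : ∀ {v} (σ : Vector (MeCarrier M e) v) u →
                       proj₁ (eval Mₑ σ (projectTerm u)) ≈ᴹ eval Mᴸ (map proj₁ σ) u *ᵣ e
    eval-projectTerm σ (var i)   = Me-fixed (σ i)
    eval-projectTerm σ (par a)   = ≈ᴹ-refl
    eval-projectTerm σ zer       = ≈ᴹ-sym (*ᵣ-zeroˡ e)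
    eval-projectTerm σ (add u w) =
      ≈ᴹ-trans (+ᴹ-cong (eval-projectTerm σ u) (eval-projectTerm σ w)) (≈ᴹ-sym (*ᵣ-distribʳ e _ _))
    eval-projectTerm σ (neg u)   = ≈ᴹ-trans (-ᴹ‿cong (eval-projectTerm σ u)) (-ᴹ‿distribˡ-*ᵣ _ e)
    eval-projectTerm σ (act u s) = begin
      proj₁ (eval Mₑ σ (projectTerm u)) *ᵣ (s * e)  ≈⟨ *ᵣ-congʳ (eval-projectTerm σ u) ⟩
      (⟦ u ⟧ *ᵣ e) *ᵣ (s * e)                       ≈⟨ *ᵣ-assoc (⟦ u ⟧ *ᵣ e) s e ⟨
      ((⟦ u ⟧ *ᵣ e) *ᵣ s) *ᵣ e                      ≈⟨ *ᵣ-congʳ (*ᵣ-comm-central e-central ⟦ u ⟧ s) ⟨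
      ((⟦ u ⟧ *ᵣ s) *ᵣ e) *ᵣ e                      ≈⟨ *ᵣe≈[e] (⟦ u ⟧ *ᵣ s) ⟩
      (⟦ u ⟧ *ᵣ s) *ᵣ e                             ∎
      where ⟦_⟧ = eval Mᴸ (map proj₁ σ)

    projectPP : ∀ {n} → PPFormula Mᴸ n → PPFormula Mₑ n
    projectPP φ = record
      { nex = nex φ ; neq = neq φ ; lhs = projectTerm ∘ lhs φ ; rhs = projectTerm ∘ rhs φ }

    Sat-projectPP⁺ : ∀ {n} (φ : PPFormula Mᴸ n) {σ} → SatProj e φ (map proj₁ σ) → Sat Mₑ (projectPP φ) σ
    Sat-projectPP⁺ φ {σ} (w , holds) = map project w , λ j → begin
      proj₁ (eval Mₑ (σ ++ map project w) (projectTerm (lhs φ j)))  ≈⟨ eval-projectTerm-++ (lhs φ j) ⟩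
      eval Mᴸ (map proj₁ σ ++ w) (lhs φ j) *ᵣ e                     ≈⟨ holds j ⟩
      eval Mᴸ (map proj₁ σ ++ w) (rhs φ j) *ᵣ e                     ≈⟨ eval-projectTerm-++ (rhs φ j) ⟨
      proj₁ (eval Mₑ (σ ++ map project w) (projectTerm (rhs φ j)))  ∎
      where
      eval-projectTerm-++ : ∀ u → proj₁ (eval Mₑ (σ ++ map project w) (projectTerm u))
                                    ≈ᴹ eval Mᴸ (map proj₁ σ ++ w) u *ᵣ e
      eval-projectTerm-++ u = ≈ᴹ-trans (eval-projectTerm _ u) (eval-≈[]-cong e-central
        (λ i → ≈ᴹ-trans (≗⇒≈[] e (map-++ proj₁ σ (map project w)) i)
                        (++⁺ _≈[ e ]_ (λ _ → ≈ᴹ-refl) (*ᵣe≈[e] ∘ w) i)) u)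

    Sat-projectPP⁻ : ∀ {n} (φ : PPFormula Mᴸ n) {σ} → Sat Mₑ (projectPP φ) σ → SatProj e φ (map proj₁ σ)
    Sat-projectPP⁻ φ {σ} (τ , holds) = map proj₁ τ , λ j → begin
      eval Mᴸ (map proj₁ σ ++ map proj₁ τ) (lhs φ j) *ᵣ e   ≈⟨ eval-projectTerm-++ (lhs φ j) ⟨
      proj₁ (eval Mₑ (σ ++ τ) (projectTerm (lhs φ j)))      ≈⟨ holds j ⟩
      proj₁ (eval Mₑ (σ ++ τ) (projectTerm (rhs φ j)))      ≈⟨ eval-projectTerm-++ (rhs φ j) ⟩
      eval Mᴸ (map proj₁ σ ++ map proj₁ τ) (rhs φ j) *ᵣ e   ∎
      where
      eval-projectTerm-++ : ∀ u → proj₁ (eval Mₑ (σ ++ τ) (projectTerm u))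
                                    ≈ᴹ eval Mᴸ (map proj₁ σ ++ map proj₁ τ) u *ᵣ e
      eval-projectTerm-++ u = ≈ᴹ-trans (eval-projectTerm (σ ++ τ) u)
        (*ᵣ-congʳ (≈ᴹ-reflexive (eval-≗ Mᴸ (map-++ proj₁ σ τ) u)))

    liftTerm : ∀ {v} → Term Mₑ v → Term Mᴸ v
    liftTerm (var i)   = act (var i) e
    liftTerm (par a)   = par (proj₁ a)
    liftTerm zer       = zer
    liftTerm (add u w) = add (liftTerm u) (liftTerm w)
    liftTerm (neg u)   = neg (liftTerm u)
    liftTerm (act u s) = act (liftTerm u) (proj₁ s)

    eval-liftTerm : ∀ {v} (ρ : Vector Carrierᴹ v) u →
                    eval Mᴸ ρ (liftTerm u) ≡ proj₁ (eval Mₑ (map project ρ) u)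
    eval-liftTerm ρ (var i)   = ≡.refl
    eval-liftTerm ρ (par a)   = ≡.refl
    eval-liftTerm ρ zer       = ≡.refl
    eval-liftTerm ρ (add u w) = ≡.cong₂ _+ᴹ_ (eval-liftTerm ρ u) (eval-liftTerm ρ w)
    eval-liftTerm ρ (neg u)   = ≡.cong -ᴹ_ (eval-liftTerm ρ u)
    eval-liftTerm ρ (act u s) = ≡.cong (_*ᵣ proj₁ s) (eval-liftTerm ρ u)

    evalₑ-cong : ∀ {v} {σ σ′ : Vector (MeCarrier M e) v} → Pointwise _≈ₑ_ σ σ′ →
                 ∀ u → eval Mₑ σ u ≈ₑ eval Mₑ σ′ u
    evalₑ-cong σ≈σ′ (var i)   = σ≈σ′ i
    evalₑ-cong σ≈σ′ (par a)   = ≈ᴹ-refl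
    evalₑ-cong σ≈σ′ zer       = ≈ᴹ-refl
    evalₑ-cong σ≈σ′ (add u w) = +ᴹ-cong (evalₑ-cong σ≈σ′ u) (evalₑ-cong σ≈σ′ w)
    evalₑ-cong σ≈σ′ (neg u)   = -ᴹ‿cong (evalₑ-cong σ≈σ′ u)
    evalₑ-cong σ≈σ′ (act u s) = *ᵣ-congʳ (evalₑ-cong σ≈σ′ u)

    liftPP : ∀ {n} → PPFormula Mₑ n → PPFormula Mᴸ n
    liftPP φ = record
      { nex = nex φ ; neq = neq φ ; lhs = liftTerm ∘ lhs φ ; rhs = liftTerm ∘ rhs φ }

    Sat-liftPP⁺ : ∀ {n} (φ : PPFormula Mₑ n) {x} → Sat Mₑ φ (map project x) → Sat Mᴸ (liftPP φ) x
    Sat-liftPP⁺ φ {x} (τ , holds) = map proj₁ τ , λ j → begin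
      eval Mᴸ (x ++ map proj₁ τ) (liftTerm (lhs φ j))  ≈⟨ eval-liftTerm-++ (lhs φ j) ⟩
      proj₁ (eval Mₑ (map project x ++ τ) (lhs φ j))   ≈⟨ holds j ⟩
      proj₁ (eval Mₑ (map project x ++ τ) (rhs φ j))   ≈⟨ eval-liftTerm-++ (rhs φ j) ⟨
      eval Mᴸ (x ++ map proj₁ τ) (liftTerm (rhs φ j))  ∎
      where
      eval-liftTerm-++ : ∀ u → eval Mᴸ (x ++ map proj₁ τ) (liftTerm u)
                                 ≈ᴹ proj₁ (eval Mₑ (map project x ++ τ) u)
      eval-liftTerm-++ u = ≈ᴹ-trans (≈ᴹ-reflexive (eval-liftTerm _ u)) (evalₑ-cong
        (λ i → ≈ᴹ-trans (≈ᴹ-reflexive (≡.cong proj₁ (map-++ project x (map proj₁ τ) i)))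
                        (++⁺ _≈ₑ_ (λ _ → ≈ᴹ-refl) (≈ᴹ-sym ∘ Me-fixed ∘ τ) i)) u)

    Sat-liftPP⁻ : ∀ {n} (φ : PPFormula Mₑ n) {x} → Sat Mᴸ (liftPP φ) x → Sat Mₑ φ (map project x)
    Sat-liftPP⁻ φ {x} (w , holds) = map project w , λ j →
      ≡.subst₂ _≈ᴹ_ (eval-liftTerm-++ (lhs φ j)) (eval-liftTerm-++ (rhs φ j)) (holds j)
      where
      eval-liftTerm-++ : ∀ u → eval Mᴸ (x ++ w) (liftTerm u)
                                 ≡ proj₁ (eval Mₑ (map project x ++ map project w) u)
      eval-liftTerm-++ u = ≡.trans (eval-liftTerm (x ++ w) u)
        (≡.cong proj₁ (eval-≗ Mₑ (map-++ project x w) u))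

    restrictᶠ : ∀ {n} → (Vector Carrierᴹ n → Vector Carrierᴹ n) →
                Vector (MeCarrier M e) n → Vector (MeCarrier M e) n
    restrictᶠ f x = map project (f (map proj₁ x))

    restrict-isPPDefBij : ∀ {n} {f : Vector Carrierᴹ n → Vector Carrierᴹ n} →
                          IsPPDefBij Mᴸ f → IsPPDefBij Mₑ (restrictᶠ f)
    restrict-isPPDefBij {n} {f} f-pp = record
      { f-cong     = λ x≈y j → *ᵣ-congʳ (f-cong x≈y j)
      ; injective  = λ {x} {y} fx≈[e]fy → injective λ j →
          -- x and y are both killed by ē, so their images agree modulo ē as well

          ≈[e]∧≈[ē]⇒≈ (fx≈[e]fy j) (Ē.f-≈[e]-cong f-pp (λ i → ≈ᴹ-trans (Me-*ᵣē≈0 (x i))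
                                                          (≈ᴹ-sym (Me-*ᵣē≈0 (y i)))) j)
      ; surjective = surj
      ; graph      = projectPP graph
      ; defines    = λ x y → graph⇒ x y , graph⇐ x y
      }
      where
      open IsPPDefBij f-pp

      surj : ∀ y → Σ (Vector (MeCarrier M e) n) λ x → ∀ j → proj₁ (restrictᶠ f x j) ≈ᴹ proj₁ (y j)
      surj y = map project x , λ j → begin
        f (map (_*ᵣ e) x) j *ᵣ e  ≈⟨ f-≈[e]-cong f-pp (*ᵣe≈[e] ∘ x) j ⟩
        f x j *ᵣ e                ≈⟨ *ᵣ-congʳ (fx≈y j) ⟩
        proj₁ (y j) *ᵣ e          ≈⟨ Me-fixed (y j) ⟨
        proj₁ (y j)               ∎
        where open Σ (surjective (map proj₁ y)) renaming (proj₁ to x; proj₂ to fx≈y)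

      graph⇒ : ∀ x y → Sat Mₑ (projectPP graph) (x ++ y) → ∀ j → proj₁ (restrictᶠ f x j) ≈ᴹ proj₁ (y j)
      graph⇒ x y sat j = ≈ᴹ-trans (SatProj-graph⇒ f-pp (SatProj-cong e-central graph
        (≗⇒≈[] e (map-++ proj₁ x y)) (Sat-projectPP⁻ graph sat)) j) (≈ᴹ-sym (Me-fixed (y j)))

      graph⇐ : ∀ x y → (∀ j → proj₁ (restrictᶠ f x j) ≈ᴹ proj₁ (y j)) → Sat Mₑ (projectPP graph) (x ++ y)
      graph⇐ x y fx≈y = Sat-projectPP⁺ graph (SatProj-cong e-central graph
        (λ i → ≈ᴹ-trans (++⁺ _≈[ e ]_ (λ _ → ≈ᴹ-refl) (λ j → ≈ᴹ-trans (fx≈y j) (Me-fixed (y j))) i)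
                        (≗⇒≈[] e (≡.sym ∘ map-++ proj₁ x y) i))
        (Sat⇒SatProj e graph (proj₂ (defines (map proj₁ x) _) (λ _ → ≈ᴹ-refl))))

    restrict : ∀ {n} → Υ Mᴸ n → Υ Mₑ n
    restrict (f , f-pp) = restrictᶠ f , restrict-isPPDefBij f-pp

    restrict-∘ : ∀ {n} (F G H : Υ Mᴸ n) → _≈Υ_ Mᴸ (proj₁ H) (proj₁ F ∘ proj₁ G) →
                 _≈Υ_ Mₑ (proj₁ (restrict H)) (proj₁ (restrict F) ∘ proj₁ (restrict G))
    restrict-∘ (f , f-pp) (g , _) (h , _) h≈f∘g x j = begin
      h x̂ j *ᵣ e                  ≈⟨ *ᵣ-congʳ (h≈f∘g x̂ j) ⟩
      f (g x̂) j *ᵣ e              ≈⟨ f-≈[e]-cong f-pp (*ᵣe≈[e] ∘ g x̂) j ⟨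
      f (map (_*ᵣ e) (g x̂)) j *ᵣ e ∎
      where x̂ = map proj₁ x

    module _ {n} (h : Υ Mₑ n) where
      open IsPPDefBij (proj₂ h)

      liftᶠ : Vector Carrierᴹ n → Vector Carrierᴹ n
      liftᶠ x = map proj₁ (proj₁ h (map project x))

      Sat-liftGraph⁻ : ∀ {x y} → Sat Mᴸ (liftPP graph) (x ++ y) → Pointwise _≈ᴹ_ (liftᶠ x) (map (_*ᵣ e) y)
      Sat-liftGraph⁻ {x} {y} sat =
        proj₁ (defines (map project x) (map project y))
          (Sat-≗ Mₑ graph (map-++ project x y) (Sat-liftPP⁻ graph sat))

      Sat-liftGraph⁺ : ∀ {x y} → Pointwise _≈ᴹ_ (liftᶠ x) (map (_*ᵣ e) y) → Sat Mᴸ (liftPP graph) (x ++ y)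
      Sat-liftGraph⁺ {x} {y} hx≈y =
        Sat-liftPP⁺ graph (Sat-≗ Mₑ graph (≡.sym ∘ map-++ project x y) (proj₂ (defines _ _) hx≈y))

  -- Decomposition along e₁, …, eₖ

  *ᵣ-distribˡ-∑ : ∀ {k} x (a : Fin k → Carrier) → x *ᵣ ∑ S a ≈ᴹ sum (λ i → x *ᵣ a i)
  *ᵣ-distribˡ-∑ {zero}  x a = *ᵣ-zeroʳ x
  *ᵣ-distribˡ-∑ {suc k} x a = ≈ᴹ-trans (*ᵣ-distribˡ x _ _) (+ᴹ-congˡ (*ᵣ-distribˡ-∑ x (a ∘ suc)))

  *ᵣ-distribʳ-sum : ∀ {k} (xs : Vector Carrierᴹ k) s → sum xs *ᵣ s ≈ᴹ sum (map (_*ᵣ s) xs)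
  *ᵣ-distribʳ-sum {zero}  xs s = *ᵣ-zeroˡ s
  *ᵣ-distribʳ-sum {suc k} xs s = ≈ᴹ-trans (*ᵣ-distribʳ s _ _) (+ᴹ-congˡ (*ᵣ-distribʳ-sum (xs ∘ suc) s))

  sum-single : ∀ {k} (xs : Vector Carrierᴹ k) l → (∀ i → i ≢ l → xs i ≈ᴹ 0ᴹ) → sum xs ≈ᴹ xs l
  sum-single {suc k} xs l xs≈0 = begin
    sum xs                           ≈⟨ sum-remove xs ⟩
    xs l +ᴹ sum (removeAt xs l)      ≈⟨ +ᴹ-congˡ (sum-cong-≋ (λ i → xs≈0 (punchIn l i) (punchInᵢ≢i l i))) ⟩
    xs l +ᴹ sum (replicate k 0ᴹ)     ≈⟨ +ᴹ-congˡ (sum-replicate-zero k) ⟩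
    xs l +ᴹ 0ᴹ                       ≈⟨ +ᴹ-identityʳ (xs l) ⟩
    xs l                             ∎

  module Decomposition {k ρ ℓρ} (D : SemisimpleDecomposition S k ρ ℓρ) where
    open SemisimpleDecomposition D using (e; central; idempotent; orthogonal; sum-one)

    e-centralIdempotent : ∀ i → IsCentralIdempotent S (e i)
    e-centralIdempotent i = record { central = central i ; idempotent = idempotent i }

    module C (i : Fin k) = Component (e-centralIdempotent i)

    x≈∑x*ᵣe : ∀ x → x ≈ᴹ sum (λ i → x *ᵣ e i)
    x≈∑x*ᵣe x = begin
      x                     ≈⟨ *ᵣ-identityʳ x ⟨
      x *ᵣ 1#               ≈⟨ *ᵣ-congˡ sum-one ⟨
      x *ᵣ ∑ S e            ≈⟨ *ᵣ-distribˡ-∑ x e ⟩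
      sum (λ i → x *ᵣ e i)  ∎

    ≈-from-components : ∀ {x y} → (∀ i → x ≈[ e i ] y) → x ≈ᴹ y
    ≈-from-components {x} {y} x≈y = begin
      x                     ≈⟨ x≈∑x*ᵣe x ⟩
      sum (λ i → x *ᵣ e i)  ≈⟨ sum-cong-≋ x≈y ⟩
      sum (λ i → y *ᵣ e i)  ≈⟨ x≈∑x*ᵣe y ⟨
      y                     ∎

    Me-orthogonal : ∀ i l → i ≢ l → (x : MeCarrier M (e i)) → proj₁ x *ᵣ e l ≈ᴹ 0ᴹ
    Me-orthogonal i l i≢l (x , x′ , x≈x′e) = begin
      x *ᵣ e l              ≈⟨ *ᵣ-congʳ x≈x′e ⟩
      (x′ *ᵣ e i) *ᵣ e l    ≈⟨ *ᵣ-assoc x′ (e i) (e l) ⟩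
      x′ *ᵣ (e i * e l)     ≈⟨ *ᵣ-congˡ (orthogonal i l i≢l) ⟩
      x′ *ᵣ 0#              ≈⟨ *ᵣ-zeroʳ x′ ⟩
      0ᴹ                    ∎

    sum-*ᵣe : (a : ∀ i → MeCarrier M (e i)) → ∀ l → sum (λ i → proj₁ (a i)) *ᵣ e l ≈ᴹ proj₁ (a l)
    sum-*ᵣe a l = begin
      sum (λ i → proj₁ (a i)) *ᵣ e l    ≈⟨ *ᵣ-distribʳ-sum (λ i → proj₁ (a i)) (e l) ⟩
      sum (λ i → proj₁ (a i) *ᵣ e l)    ≈⟨ sum-single _ l (λ i i≢l → Me-orthogonal i l i≢l (a i)) ⟩
      proj₁ (a l) *ᵣ e l                ≈⟨ C.Me-fixed l (a l) ⟨
      proj₁ (a l)                       ∎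

    module _ {n} (h : ∀ i → Υ (C.Mₑ i) n) where
      private
        module h (i : Fin k) = IsPPDefBij (proj₂ (h i))

      glueᶠ : Vector Carrierᴹ n → Vector Carrierᴹ n
      glueᶠ x j = sum (λ i → C.liftᶠ i (h i) x j)

      glueᶠ-*ᵣe : ∀ x j l → glueᶠ x j *ᵣ e l ≈ᴹ C.liftᶠ l (h l) x j
      glueᶠ-*ᵣe x j = sum-*ᵣe (λ i → proj₁ (h i) (map (C.project i) x) j)

      glue-isPPDefBij : IsPPDefBij Mᴸ glueᶠ
      glue-isPPDefBij = record
        { f-cong     = λ x≈y j → sum-cong-≋ (λ i → h.f-cong i (λ j′ → *ᵣ-congʳ (x≈y j′)) j)
        ; injective  = λ {x} {y} gx≈gy j → ≈-from-components λ l → h.injective l (λ j′ → begin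
            C.liftᶠ l (h l) x j′  ≈⟨ glueᶠ-*ᵣe x j′ l ⟨
            glueᶠ x j′ *ᵣ e l     ≈⟨ *ᵣ-congʳ (gx≈gy j′) ⟩
            glueᶠ y j′ *ᵣ e l     ≈⟨ glueᶠ-*ᵣe y j′ l ⟩
            C.liftᶠ l (h l) y j′  ∎) j
        ; surjective = surj
        ; graph      = ⋀ᵖ Mᴸ (λ i → C.liftPP i (h.graph i))
        ; defines    = λ x y →
            (λ sat j → ≈-from-components λ l →
               ≈ᴹ-trans (glueᶠ-*ᵣe x j l) (C.Sat-liftGraph⁻ l (h l) (Sat-⋀ᵖ⁻ Mᴸ _ sat l) j))
          , (λ gx≈y → Sat-⋀ᵖ⁺ Mᴸ _ λ l → C.Sat-liftGraph⁺ l (h l) λ j →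
               ≈ᴹ-trans (≈ᴹ-sym (glueᶠ-*ᵣe x j l)) (*ᵣ-congʳ (gx≈y j)))
        }
        where
        surj : ∀ y → Σ (Vector Carrierᴹ n) λ x → ∀ j → glueᶠ x j ≈ᴹ y j
        surj y = x , λ j → ≈-from-components λ l → begin
          glueᶠ x j *ᵣ e l             ≈⟨ glueᶠ-*ᵣe x j l ⟩
          C.liftᶠ l (h l) x j          ≈⟨ h.f-cong l (λ j′ → sum-*ᵣe (λ i → X i j′) l) j ⟩
          proj₁ (proj₁ (h l) (X l) j)  ≈⟨ proj₂ (h.surjective l (map (C.project l) y)) j ⟩
          y j *ᵣ e l                   ∎
          where
          X : ∀ i → Vector (MeCarrier M (e i)) n
          X i = proj₁ (h.surjective i (map (C.project i) y))
          x : Vector Carrierᴹ n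
          x j = sum (λ i → proj₁ (X i j))

      glue : Υ Mᴸ n
      glue = glueᶠ , glue-isPPDefBij

      restrict-glue : ∀ i → _≈Υ_ (C.Mₑ i) (proj₁ (C.restrict i glue)) (proj₁ (h i))
      restrict-glue i x j = ≈ᴹ-trans (glueᶠ-*ᵣe (map proj₁ x) j i)
        (h.f-cong i (λ j′ → ≈ᴹ-sym (C.Me-fixed i (x j′))) j)

    restrict-injective : ∀ {n} (F G : Υ Mᴸ n) →
                         (∀ i → _≈Υ_ (C.Mₑ i) (proj₁ (C.restrict i F)) (proj₁ (C.restrict i G))) →
                         _≈Υ_ Mᴸ (proj₁ F) (proj₁ G)
    restrict-injective (f , f-pp) (g , g-pp) f≈g x j = ≈-from-components λ l → begin
      f x j *ᵣ e l                  ≈⟨ C.f-≈[e]-cong l f-pp (C.*ᵣe≈[e] l ∘ x) j ⟨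
      f (map (_*ᵣ e l) x) j *ᵣ e l  ≈⟨ f≈g l (map (C.project l) x) j ⟩
      g (map (_*ᵣ e l) x) j *ᵣ e l  ≈⟨ C.f-≈[e]-cong l g-pp (C.*ᵣe≈[e] l ∘ x) j ⟩
      g x j *ᵣ e l                  ∎

    iso : ∀ n → ΥIsoProduct n Mᴸ k (λ i → MeStructure M (e i))
    iso n = record
      { to      = λ F i → C.restrict i F
      ; to-cong = λ F G F≈G i x j → *ᵣ-congʳ (F≈G (map proj₁ x) j)
      ; to-inj  = restrict-injective
      ; to-surj = λ h → glue h , restrict-glue h
      ; to-hom  = λ F G H H≈FG i → C.restrict-∘ i F G H H≈FG
      }

corollary6p12 : ∀ {r ℓr m ℓm ρ ℓρ : Level}
    (S : Ring r ℓr) (k : ℕ) (D : SemisimpleDecomposition S k ρ ℓρ)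
    (M : RightModule S m ℓm)
    → (∀ (i : Fin k) → Infinite (MeCarrier M (SemisimpleDecomposition.e D i))
                                (LStructure._≈_ (MeStructure M (SemisimpleDecomposition.e D i))))
    → ∀ (n : ℕ) → 1 ≤ n
    → ΥIsoProduct n (asLStructure M) k
                  (λ i → MeStructure M (SemisimpleDecomposition.e D i))
corollary6p12 S k D M _ n _ = Decomposition.iso M D n
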